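{- For any non-trivial connected graph $G$ and any integer $t\ge 2D(G)+1$, $$\dim_l(P_t\boxtimes G)\ge \left\lceil\frac{t-1}{D(G)}\right\rceil+1.$$
   Context: $P_t$ is the path on $t$ vertices and $D(G)$ is the diameter of $G$. A set $S$ is a local metric generator for a connected graph $X$ if for every two adjacent vertices $x,y$ there is $s\in S$ with $d_X(s,x)\ne d_X(s,y)$; $\dim_l(X)$ is the minimum cardinality of a local metric generator. The strong product $P_t\boxtimes G$ has vertex set $V(P_t)\times V(G)$, with $(a,b)\sim(c,d)$ iff ($a=c$ and $b\sim d$) or ($b=d$ and $a\sim c$) or ($a\sim c$ and $b\sim d$). -}

module Defs where

open import Level using (0ℓ)
open import Data.Nat using (ℕ; zero; suc; _+_; _*_; _∸_; _≤_; _/_)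
open import Data.Fin using (Fin; toℕ)
open import Data.Product using (Σ; ∃; _×_; _,_)
open import Data.Sum using (_⊎_)
open import Data.List using (List; length)
open import Data.List.Membership.Propositional using (_∈_)
open import Relation.Binary.PropositionalEquality using (_≡_; _≢_)
open import Relation.Nullary using (¬_)

record Graph (V : Set) : Set₁ where
  field
    Adj    : V → V → Set
    sym    : ∀ {x y} → Adj x y → Adj y x
    irrefl : ∀ {x} → ¬ Adj x x
open Graph public

data Walk {V : Set} (G : Graph V) : V → V → ℕ → Set where
  here : ∀ {x} → Walk G x x 0
  step : ∀ {x y z k} → Adj G x y → Walk G y z k → Walk G x z (suc k)

Dist : {V : Set} → Graph V → V → V → ℕ → Set
Dist G x y k = Walk G x y k × (∀ m → Walk G x y m → k ≤ m)

Connected : {V : Set} → Graph V → Set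
Connected {V} G = ∀ (x y : V) → ∃ λ k → Walk G x y k

IsDiameter : {V : Set} → Graph V → ℕ → Set
IsDiameter {V} G D =
  (∀ (x y : V) k → Dist G x y k → k ≤ D) ×
  Σ V λ x → Σ V λ y → Dist G x y D

PathGraph : (t : ℕ) → Graph (Fin t)
PathGraph t = record
  { Adj = λ i j → suc (toℕ i) ≡ toℕ j ⊎ suc (toℕ j) ≡ toℕ i
  ; sym = λ { (Data.Sum.inj₁ p) → Data.Sum.inj₂ p ; (Data.Sum.inj₂ p) → Data.Sum.inj₁ p }
  ; irrefl = λ { {i} (Data.Sum.inj₁ p) → n≢sn p ; {i} (Data.Sum.inj₂ p) → n≢sn p }
  }
  where
    n≢sn : ∀ {n} → suc n ≢ n
    n≢sn ()

_⊠_ : {U V : Set} → Graph U → Graph V → Graph (U × V)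
_⊠_ {U} {V} H G = record
  { Adj = A
  ; sym = λ { (Data.Sum.inj₁ (p , q)) → Data.Sum.inj₁ (Eq.sym p , sym G q)
            ; (Data.Sum.inj₂ (Data.Sum.inj₁ (p , q))) → Data.Sum.inj₂ (Data.Sum.inj₁ (Eq.sym p , sym H q))
            ; (Data.Sum.inj₂ (Data.Sum.inj₂ (p , q))) → Data.Sum.inj₂ (Data.Sum.inj₂ (sym H p , sym G q)) }
  ; irrefl = λ { (Data.Sum.inj₁ (_ , q)) → irrefl G q
               ; (Data.Sum.inj₂ (Data.Sum.inj₁ (_ , q))) → irrefl H q
               ; (Data.Sum.inj₂ (Data.Sum.inj₂ (p , _))) → irrefl H p }
  }
  where
    import Relation.Binary.PropositionalEquality as Eq
    A : U × V → U × V → Set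
    A (a , b) (c , d) = (a ≡ c × Adj G b d) ⊎ ((b ≡ d × Adj H a c) ⊎ (Adj H a c × Adj G b d))

IsLocalMetricGenerator : {V : Set} → Graph V → List V → Set
IsLocalMetricGenerator {V} X S =
  ∀ (x y : V) → Adj X x y →
    Σ V λ s → s ∈ S × Σ ℕ λ a → Σ ℕ λ b → Dist X s x a × Dist X s y b × a ≢ b

LocalDimAtLeast : {V : Set} → Graph V → ℕ → Set
LocalDimAtLeast {V} X k = ∀ (S : List V) → IsLocalMetricGenerator X S → k ≤ length S

-- Ceiling division ⌈a / d⌉ (junk value 0 when d = 0).
⌈_/_⌉ : ℕ → ℕ → ℕ
⌈ a / zero ⌉ = 0
⌈ a / suc d ⌉ = (a + d) / suc d

-- A landmark (c , w) of P_t ⊠ G cannot resolve an edge uv of column i once u and v lie within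
-- |i − c| of w in G, since then the path coordinate realises both distances; in particular it
-- resolves no edge of a column at distance at least D from c. Given k landmarks and a window of
-- 2 + (k − 1)D columns starting at L, some edge of some column is resolved by none of them:
-- a landmark at or left of L is dropped by moving the window D columns to the right; if at most
-- one landmark lies strictly between L and L + D, an edge at its vertex (or any edge) of column
-- L is unresolved; two such landmarks are dropped by moving the window 2D columns, unless they
-- are all the landmarks, in which case in one of the columns L, L + D + 1 their gaps sum to more
-- than D ≥ d(w₁, w₂), and then their two balls share an edge. If |S| ≤ ⌈(t − 1)/D⌉, the
-- whole of P_t is such a window, so S is not a local metric generator.

module Submission where

open import Defs
open import Data.Nat using (ℕ; zero; suc; _+_; _*_; _∸_; _≤_; _<_; z≤n; s≤s; ∣_-_∣)
open import Data.Nat.Properties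
open import Data.Nat.DivMod using (m/n*n≤m)
open import Data.Nat.Induction using (<-rec)
open import Data.Nat.Tactic.RingSolver using (solve-∀)
open import Data.Fin as Fin using (Fin; toℕ; fromℕ<)
open import Data.Fin.Properties using (toℕ-injective; toℕ-fromℕ<; toℕ<n; sequence)
open import Data.List using (List; []; _∷_; length)
open import Data.List.Properties using (length-removeAt′)
open import Data.List.Relation.Unary.All as All using (All; []; _∷_)
open import Data.List.Relation.Unary.All.Properties using (─⁺; ─⁻; ¬Any⇒All¬)
open import Data.List.Relation.Unary.Any as Any using (Any; _─_; any?)
open import Data.List.Relation.Unary.Any.Properties using (lookup-index)
open import Data.Product using (∃; ∃₂; _×_; _,_; proj₁; proj₂)
open import Data.Sum using (_⊎_; inj₁; inj₂)
open import Effect.Monad using (RawMonad)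
open import Function using (_∘_)
open import Relation.Nullary using (¬_; Dec; yes; no; contradiction)
open import Relation.Nullary.Decidable using (decidable-stable; _×-dec_)
open import Relation.Nullary.Negation using (¬¬-Monad)
open import Relation.Binary.PropositionalEquality as ≡ using (_≡_; _≢_; refl; cong; subst)

module _ {V : Set} {G : Graph V} where

  reverseOnto : ∀ {x y z a b} → Walk G x y a → Walk G x z b → Walk G y z (a + b)
  reverseOnto here acc = acc
  reverseOnto {b = b} (step {k = a} e w) acc =
    subst (Walk G _ _) (+-suc a b) (reverseOnto w (step (sym G e) acc))

  reverse : ∀ {x y a} → Walk G x y a → Walk G y x a
  reverse {a = a} w = subst (Walk G _ _) (+-identityʳ a) (reverseOnto w here)

  firstStep : ∀ {x y a} → x ≢ y → Walk G x y a → ∃ (Adj G x)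
  firstStep x≢x here = contradiction refl x≢x
  firstStep _ (step e _) = _ , e

WalkWithin : {V : Set} → Graph V → ℕ → V → V → Set
WalkWithin G r x y = ∃ λ l → l ≤ r × Walk G x y l

EdgeWithin : {V : Set} → Graph V → ℕ → V → V → V → Set
EdgeWithin G r w u v = WalkWithin G r w u × WalkWithin G r w v

module _ {V : Set} {G : Graph V} where

  within-mono : ∀ {r r′ x y} → r ≤ r′ → WalkWithin G r x y → WalkWithin G r′ x y
  within-mono r≤r′ (l , l≤r , p) = l , ≤-trans l≤r r≤r′ , p

  within-refl : ∀ {r x} → WalkWithin G r x x
  within-refl = 0 , z≤n , here

  within-adj : ∀ {r x y} → 1 ≤ r → Adj G x y → WalkWithin G r x y
  within-adj 1≤r e = 1 , 1≤r , step e here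

  within-step : ∀ {r x y z} → Adj G x y → WalkWithin G r y z → WalkWithin G (suc r) x z
  within-step e (l , l≤r , p) = suc l , s≤s l≤r , step e p

  CommonEdge : ℕ → V → ℕ → V → Set
  CommonEdge r₁ w₁ r₂ w₂ = ∃₂ λ u v → Adj G u v × EdgeWithin G r₁ w₁ u v × EdgeWithin G r₂ w₂ u v

  commonFirstEdge : ∀ {r₁ r₂ w₁ y w₂ m} → Adj G w₁ y → Walk G y w₂ m → 1 ≤ r₁ → suc m ≤ r₂ →
                    CommonEdge r₁ w₁ r₂ w₂
  commonFirstEdge {m = m} e p 1≤r₁ m<r₂ =
    _ , _ , e , (within-refl , within-adj 1≤r₁ e) ,
    ((suc m , m<r₂ , reverse (step e p)) , (m , <⇒≤ m<r₂ , reverse p))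

  -- Walk from w₁ towards w₂, shrinking the first radius, until the current
  -- edge lies within the second radius.
  commonEdge : (∀ w → ∃ (Adj G w)) → ∀ {w₁ w₂ m} r₁ r₂ → Walk G w₁ w₂ m →
               1 ≤ r₁ → 1 ≤ r₂ → m < r₁ + r₂ → CommonEdge r₁ w₁ r₂ w₂
  commonEdge nb {w₁} r₁ r₂ here 1≤r₁ 1≤r₂ _ =
    let (v , e) = nb w₁ in w₁ , v , e , (within-refl , within-adj 1≤r₁ e) , (within-refl , within-adj 1≤r₂ e)
  commonEdge nb (suc zero) r₂ (step e p) 1≤r₁ _ m<r₁+r₂ = commonFirstEdge e p 1≤r₁ (≤-pred m<r₁+r₂)
  commonEdge nb (suc (suc r₁)) r₂ (step {k = m} e p) 1≤r₁ 1≤r₂ m<r₁+r₂ with suc m ≤? r₂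
  ... | yes m<r₂ = commonFirstEdge e p 1≤r₁ m<r₂
  ... | no _ =
    let (u , v , e′ , (u₁ , v₁) , near₂) = commonEdge nb (suc r₁) r₂ p (s≤s z≤n) 1≤r₂ (≤-pred m<r₁+r₂)
    in u , v , e′ , (within-step e u₁ , within-step e v₁) , near₂

¬¬-least : {P : ℕ → Set} → ∀ n → P n → ¬ ¬ (∃ λ m → P m × ∀ k → P k → m ≤ k)
¬¬-least {P} = <-rec (λ n → P n → ¬ ¬ _) λ n smaller Pn ¬least →
  ¬least (n , Pn , λ k Pk → decidable-stable (n ≤? k) λ n≰k → smaller (≰⇒> n≰k) Pk ¬least)

module _ {V : Set} {G : Graph V} where

  -- Walks are not decidable, so a shortest walk, hence the distance, exists only classically.
  ¬¬-withinDiameter : Connected G → ∀ {D} → IsDiameter G D → ∀ x y → ¬ ¬ WalkWithin G D x y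
  ¬¬-withinDiameter conn (bounded , _) x y ¬within =
    ¬¬-least (proj₁ (conn x y)) (proj₂ (conn x y)) λ (m , p , least) →
      ¬within (m , bounded x y m (p , least) , p)

  1≤diameter : ∀ {D x y} → (∀ x y → WalkWithin G D x y) → Adj G x y → 1 ≤ D
  1≤diameter {x = x} {y} within e with within x y
  ... | zero , _ , here = contradiction e (irrefl G)
  ... | suc _ , s≤s _ , _ = s≤s z≤n

¬¬-∀-Fin : ∀ {n} {P : Fin n → Set} → (∀ i → ¬ ¬ P i) → ¬ ¬ (∀ i → P i)
¬¬-∀-Fin = sequence (RawMonad.rawApplicative ¬¬-Monad)

module _ {n} {G : Graph (Fin n)} (conn : Connected G) where

  ¬¬-allWithinDiameter : ∀ {D} → IsDiameter G D → ¬ ¬ (∀ x y → WalkWithin G D x y)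
  ¬¬-allWithinDiameter diam = ¬¬-∀-Fin λ x → ¬¬-∀-Fin λ y → ¬¬-withinDiameter conn diam x y

  neighbour : 2 ≤ n → ∀ x → ∃ (Adj G x)
  neighbour (s≤s (s≤s _)) x with x Fin.≟ Fin.zero
  ... | yes x≡0 = firstStep (λ x≡1 → contradiction (≡.trans (≡.sym x≡0) x≡1) λ ()) (proj₂ (conn x (Fin.suc Fin.zero)))
  ... | no x≢0 = firstStep x≢0 (proj₂ (conn x Fin.zero))

m+n≤o⇒n≤∣o-m∣ : ∀ {m n o} → m + n ≤ o → n ≤ ∣ o - m ∣
m+n≤o⇒n≤∣o-m∣ {m} {n} {o} m+n≤o =
  +-cancelʳ-≤ m n ∣ o - m ∣ (≤-trans (≤-reflexive (+-comm n m)) (≤-trans m+n≤o (m≤∣m-n∣+n o m)))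

m+n≤o⇒n≤∣m-o∣ : ∀ {m n o} → m + n ≤ o → n ≤ ∣ m - o ∣
m+n≤o⇒n≤∣m-o∣ {m} {n} {o} m+n≤o = subst (n ≤_) (∣-∣-comm o m) (m+n≤o⇒n≤∣o-m∣ m+n≤o)

m≢n⇒1≤∣m-n∣ : ∀ {m n} → m ≢ n → 1 ≤ ∣ m - n ∣
m≢n⇒1≤∣m-n∣ {m} {n} m≢n with ∣ m - n ∣ in eq
... | zero = contradiction (∣m-n∣≡0⇒m≡n eq) m≢n
... | suc _ = s≤s z≤n

1+d≤∣m-o∣+∣m+1+d-o∣ : ∀ m d o → suc d ≤ ∣ m - o ∣ + ∣ m + suc d - o ∣
1+d≤∣m-o∣+∣m+1+d-o∣ m d o = begin
  suc d                          ≡⟨ ≡.sym (∣m-m+n∣≡n m (suc d)) ⟩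
  ∣ m - m + suc d ∣              ≤⟨ ∣-∣-triangle m o (m + suc d) ⟩
  ∣ m - o ∣ + ∣ o - m + suc d ∣  ≡⟨ cong (∣ m - o ∣ +_) (∣-∣-comm o (m + suc d)) ⟩
  ∣ m - o ∣ + ∣ m + suc d - o ∣  ∎
  where open ≤-Reasoning

≤-pigeonhole : ∀ {n x₁ y₁ x₂ y₂} → n ≤ x₁ + y₁ → n ≤ x₂ + y₂ → n ≤ x₁ + x₂ ⊎ n ≤ y₁ + y₂
≤-pigeonhole {n} {x₁} {y₁} {x₂} {y₂} n≤₁ n≤₂ with n ≤? x₁ + x₂
... | yes n≤x = inj₁ n≤x
... | no n≰x = inj₂ (+-cancelˡ-≤ n n (y₁ + y₂) (begin
  n + n                    ≤⟨ +-mono-≤ n≤₁ n≤₂ ⟩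
  (x₁ + y₁) + (x₂ + y₂)    ≡⟨ interchange x₁ y₁ x₂ y₂ ⟩
  (x₁ + x₂) + (y₁ + y₂)    ≤⟨ +-monoˡ-≤ (y₁ + y₂) (<⇒≤ (≰⇒> n≰x)) ⟩
  n + (y₁ + y₂)            ∎))
  where
  open ≤-Reasoning
  interchange : ∀ a b c d → (a + b) + (c + d) ≡ (a + c) + (b + d)
  interchange = solve-∀

span : ℕ → ℕ → ℕ
span D k = 2 + (k ∸ 1) * D

+-span≤⇒< : ∀ {D k L R} → L + span D k ≤ R → L < R
+-span≤⇒< {L = L} h = ≤-trans (m<m+n L (s≤s z≤n)) h

+-span-suc : ∀ L D k → L + D + span D (suc k) ≡ L + span D (2 + k)
+-span-suc = expanded
  where
  expanded : ∀ L D k → L + D + (2 + k * D) ≡ L + (2 + (D + k * D))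
  expanded = solve-∀

+-span-suc² : ∀ L D k → L + D + D + span D (suc k) ≡ L + span D (3 + k)
+-span-suc² = expanded
  where
  expanded : ∀ L D k → L + D + D + (2 + k * D) ≡ L + (2 + (D + (D + k * D)))
  expanded = solve-∀

-- A point s stands for the landmark (column s , vertex s) of P_t ⊠ G.
module Landmarks {V : Set} (G : Graph V) {Point : Set} (column : Point → ℕ) (vertex : Point → V) where

  gap : ℕ → Point → ℕ
  gap i s = ∣ i - column s ∣

  record Blind (i : ℕ) (u v : V) (s : Point) : Set where
    constructor blind
    field edgeWithin : EdgeWithin G (gap i s) (vertex s) u v

  BlindEdge : ℕ → List Point → Set
  BlindEdge i P = ∃₂ λ u v → Adj G u v × All (Blind i u v) P

  BlindColumn : ℕ → ℕ → List Point → Set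
  BlindColumn L R P = ∃ λ i → L ≤ i × i < R × BlindEdge i P

module Blindness {V : Set} (G : Graph V) (D : ℕ) (v₀ : V) (nb : ∀ w → ∃ (Adj G w))
  (withinDiameter : ∀ x y → WalkWithin G D x y)
  {Point : Set} (column : Point → ℕ) (vertex : Point → V) where

  open Landmarks G column vertex

  blind-far : ∀ {i u v s} → D ≤ gap i s → Blind i u v s
  blind-far D≤gap = blind (within-mono D≤gap (withinDiameter _ _) , within-mono D≤gap (withinDiameter _ _))

  blind-neighbour : ∀ {i s} → i ≢ column s → Blind i (vertex s) (proj₁ (nb (vertex s))) s
  blind-neighbour i≢c = blind (within-refl , within-adj (m≢n⇒1≤∣m-n∣ i≢c) (proj₂ (nb _)))

  blindEdgeAt : ∀ {i P} w → All (Blind i w (proj₁ (nb w))) P → BlindEdge i P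
  blindEdgeAt w blinds = w , proj₁ (nb w) , proj₂ (nb w) , blinds

  blindColumn-widen : ∀ {L M R P} → L ≤ M → BlindColumn M R P → BlindColumn L R P
  blindColumn-widen L≤M (i , M≤i , i<R , edge) = i , ≤-trans L≤M M≤i , i<R , edge

  blindColumn-restore : ∀ {Q : Point → Set} {M R P} (p : Any Q P) →
                        (∀ i → M ≤ i → D ≤ gap i (Any.lookup p)) →
                        BlindColumn M R (P ─ p) → BlindColumn M R P
  blindColumn-restore p far (i , M≤i , i<R , u , v , e , blinds) =
    i , M≤i , i<R , u , v , e , ─⁻ p (blind-far (far i M≤i)) blinds

  blindColumn-one : ∀ {L R} s → L + 2 ≤ R → BlindColumn L R (s ∷ [])
  blindColumn-one {L} s L+2≤R with L ≟ column s
  ... | no L≢c = L , ≤-refl , +-span≤⇒< {D} {1} L+2≤R ,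
                  blindEdgeAt (vertex s) (blind-neighbour L≢c ∷ [])
  ... | yes refl = suc L , n≤1+n L , ≤-trans (≤-reflexive (+-comm 2 L)) L+2≤R ,
                  blindEdgeAt (vertex s) (blind-neighbour (<⇒≢ ≤-refl ∘ ≡.sym) ∷ [])

  Near : ℕ → Point → Set
  Near L s = L < column s × column s < L + D

  near? : ∀ L s → Dec (Near L s)
  near? L s = (L <? column s) ×-dec (column s <? L + D)

  far-at : ∀ {L s} → ¬ column s ≤ L → ¬ Near L s → D ≤ gap L s
  far-at ¬left ¬near = m+n≤o⇒n≤∣m-o∣ (≮⇒≥ (¬near ∘ (≰⇒> ¬left ,_)))

  far-beyond-left : ∀ {L i s} → column s ≤ L → L + D ≤ i → D ≤ gap i s
  far-beyond-left c≤L L+D≤i = m+n≤o⇒n≤∣o-m∣ (≤-trans (+-monoˡ-≤ D c≤L) L+D≤i)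

  far-beyond-near : ∀ {L i s} → Near L s → L + D + D ≤ i → D ≤ gap i s
  far-beyond-near (_ , c<L+D) L+2D≤i = m+n≤o⇒n≤∣o-m∣ (≤-trans (+-monoˡ-≤ D (<⇒≤ c<L+D)) L+2D≤i)

  blindEdge-pair : ∀ {i s₁ s₂} → i ≢ column s₁ → i ≢ column s₂ → suc D ≤ gap i s₁ + gap i s₂ →
                   ∃₂ λ u v → Adj G u v × Blind i u v s₁ × Blind i u v s₂
  blindEdge-pair {i} {s₁} {s₂} i≢c₁ i≢c₂ D<gaps =
    let (m , m≤D , p) = withinDiameter (vertex s₁) (vertex s₂)
        (u , v , e , within₁ , within₂) = commonEdge nb (gap i s₁) (gap i s₂) p
          (m≢n⇒1≤∣m-n∣ i≢c₁) (m≢n⇒1≤∣m-n∣ i≢c₂) (≤-trans (s≤s m≤D) D<gaps)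
    in u , v , e , blind within₁ , blind within₂

  -- The gaps of a near landmark from the columns L and L + D + 1 add up to at least D + 1,
  -- so for one of these columns the two gaps exceed the diameter.
  blindColumn-pair : ∀ {L R s₁ s₂} → L + span D 2 ≤ R → Near L s₁ → Near L s₂ →
                     ∃ λ i → L ≤ i × i < R × ∃₂ λ u v → Adj G u v × Blind i u v s₁ × Blind i u v s₂
  blindColumn-pair {L} {R} {s₁} {s₂} h (L<c₁ , c₁<L+D) (L<c₂ , c₂<L+D)
    with ≤-pigeonhole {x₁ = gap L s₁} {x₂ = gap L s₂}
           (1+d≤∣m-o∣+∣m+1+d-o∣ L D (column s₁)) (1+d≤∣m-o∣+∣m+1+d-o∣ L D (column s₂))
  ... | inj₁ D<gaps = L , ≤-refl , +-span≤⇒< {D} {2} h , blindEdge-pair (<⇒≢ L<c₁) (<⇒≢ L<c₂) D<gaps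
  ... | inj₂ D<gaps = L + suc D , m≤m+n L (suc D) , ≤-trans (≤-reflexive (pair-span L D)) h ,
                      blindEdge-pair (>⇒≢ (beyond c₁<L+D)) (>⇒≢ (beyond c₂<L+D)) D<gaps
    where
    beyond : ∀ {c} → c < L + D → c < L + suc D
    beyond c<L+D = ≤-trans c<L+D (+-monoʳ-≤ L (n≤1+n D))
    pair-span : ∀ L D → suc (L + suc D) ≡ L + (2 + (D + 0))
    pair-span = solve-∀

  length-─ : ∀ {Q : Point → Set} {P k} → length P ≡ suc k → (p : Any Q P) → length (P ─ p) ≡ k
  length-─ {P = P} len p = suc-injective (≡.trans (≡.sym (length-removeAt′ P (Any.index p))) len)

  all-empty : ∀ {Q : Point → Set} {P} → length P ≡ 0 → All Q P
  all-empty {P = []} _ = []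

  SpanBlind : ℕ → ℕ → Set
  SpanBlind k R = ∀ {L} P → length P ≡ k → L + span D k ≤ R → BlindColumn L R P

  blindColumn-twoNear : ∀ k {L R} P (p₁ : Any (Near L) P) (p₂ : Any (Near L) (P ─ p₁)) →
                        length (P ─ p₁ ─ p₂) ≡ k → L + span D (2 + k) ≤ R → SpanBlind k R →
                        BlindColumn L R P
  blindColumn-twoNear zero P p₁ p₂ len h _ with blindColumn-pair h (lookup-index p₁) (lookup-index p₂)
  ... | i , L≤i , i<R , u , v , e , blind₁ , blind₂ =
    i , L≤i , i<R , u , v , e , ─⁻ p₁ blind₁ (─⁻ p₂ blind₂ (all-empty len))
  blindColumn-twoNear (suc k) {L} P p₁ p₂ len h rest =
    blindColumn-widen (≤-trans (m≤m+n L D) (m≤m+n (L + D) D))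
      (blindColumn-restore p₁ (λ _ → far-beyond-near (lookup-index p₁))
        (blindColumn-restore p₂ (λ _ → far-beyond-near (lookup-index p₂))
          (rest (P ─ p₁ ─ p₂) len (≤-trans (≤-reflexive (+-span-suc² L D k)) h))))

  blindColumn-step : ∀ k {R} → SpanBlind (suc k) R → SpanBlind k R → SpanBlind (2 + k) R
  blindColumn-step k drop₁ drop₂ {L} P len h with any? (λ s → column s ≤? L) P
  ... | yes left =
    blindColumn-widen (m≤m+n L D) (blindColumn-restore left (λ _ → far-beyond-left (lookup-index left))
      (drop₁ (P ─ left) (length-─ len left) (≤-trans (≤-reflexive (+-span-suc L D k)) h)))
  ... | no ¬left with any? (near? L) P
  ...   | no ¬near = L , ≤-refl , +-span≤⇒< {D} {2 + k} h ,
    blindEdgeAt v₀ (All.map blind-far (All.zipWith (λ (l , n) → far-at l n) (¬Any⇒All¬ P ¬left , ¬Any⇒All¬ P ¬near)))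
  ...   | yes p₁ with any? (near? L) (P ─ p₁)
  ...     | no ¬near = L , ≤-refl , +-span≤⇒< {D} {2 + k} h ,
    blindEdgeAt (vertex (Any.lookup p₁)) (─⁻ p₁ (blind-neighbour (<⇒≢ (proj₁ (lookup-index p₁))))
      (All.map blind-far (All.zipWith (λ (l , n) → far-at l n) (─⁺ p₁ (¬Any⇒All¬ P ¬left) , ¬Any⇒All¬ _ ¬near))))
  ...     | yes p₂ = blindColumn-twoNear k P p₁ p₂ (length-─ (length-─ len p₁) p₂) h drop₂

  blindColumn : ∀ k {R} → SpanBlind k R
  blindColumn zero {L = L} [] _ h = L , ≤-refl , +-span≤⇒< {D} {0} h , blindEdgeAt v₀ []
  blindColumn (suc zero) (s ∷ []) _ h = blindColumn-one s h
  blindColumn (suc (suc k)) = blindColumn-step k (blindColumn (suc k)) (blindColumn k)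

∣1+n-n∣≡1 : ∀ n → ∣ suc n - n ∣ ≡ 1
∣1+n-n∣≡1 zero = refl
∣1+n-n∣≡1 (suc n) = ∣1+n-n∣≡1 n

module _ {t : ℕ} where

  PathAdj⇒gap≤1 : ∀ {a b : Fin t} → Adj (PathGraph t) a b → ∣ toℕ b - toℕ a ∣ ≤ 1
  PathAdj⇒gap≤1 {a} (inj₁ a+1≡b) = ≤-reflexive (subst (λ c → ∣ c - toℕ a ∣ ≡ 1) a+1≡b (∣1+n-n∣≡1 (toℕ a)))
  PathAdj⇒gap≤1 {b = b} (inj₂ b+1≡a) =
    ≤-reflexive (subst (λ c → ∣ toℕ b - c ∣ ≡ 1) b+1≡a (≡.trans (∣-∣-comm (toℕ b) (suc (toℕ b))) (∣1+n-n∣≡1 (toℕ b))))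

  ascendingWalk : ∀ d (a b : Fin t) → toℕ a + d ≡ toℕ b → Walk (PathGraph t) a b d
  ascendingWalk zero a b a+0≡b =
    subst (λ c → Walk (PathGraph t) a c 0) (toℕ-injective (≡.trans (≡.sym (+-identityʳ _)) a+0≡b)) here
  ascendingWalk (suc d) a b a+d≡b =
    step (inj₁ (≡.sym (toℕ-fromℕ< a<t))) (ascendingWalk d (fromℕ< a<t) b a′+d≡b)
    where
    a+1+d≡b : suc (toℕ a + d) ≡ toℕ b
    a+1+d≡b = ≡.trans (≡.sym (+-suc (toℕ a) d)) a+d≡b
    a<t : suc (toℕ a) < t
    a<t = ≤-<-trans (≤-trans (s≤s (m≤m+n (toℕ a) d)) (≤-reflexive a+1+d≡b)) (toℕ<n b)
    a′+d≡b : toℕ (fromℕ< a<t) + d ≡ toℕ b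
    a′+d≡b = ≡.trans (cong (_+ d) (toℕ-fromℕ< a<t)) a+1+d≡b

  pathWalk : ∀ (a b : Fin t) → Walk (PathGraph t) a b ∣ toℕ b - toℕ a ∣
  pathWalk a b with ≤-total (toℕ a) (toℕ b)
  ... | inj₁ a≤b = subst (Walk _ a b) (≡.sym (m≤n⇒∣n-m∣≡n∸m a≤b)) (ascendingWalk _ a b (m+[n∸m]≡n a≤b))
  ... | inj₂ b≤a = subst (Walk _ a b) (≡.trans (≡.sym (m≤n⇒∣n-m∣≡n∸m b≤a)) (∣-∣-comm (toℕ a) (toℕ b)))
                     (reverse (ascendingWalk _ b a (m+[n∸m]≡n b≤a)))

module _ {U V : Set} {H : Graph U} {G : Graph V} where

  ⊠-walk : ∀ {a b w u r l} → Walk H a b r → Walk G w u l → l ≤ r → Walk (H ⊠ G) (a , w) (b , u) r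
  ⊠-walk here here z≤n = here
  ⊠-walk (step e p) here _ = step (inj₂ (inj₁ (refl , e))) (⊠-walk p here z≤n)
  ⊠-walk (step e p) (step f q) (s≤s l≤r) = step (inj₂ (inj₂ (e , f))) (⊠-walk p q l≤r)

module _ {t : ℕ} {V : Set} {G : Graph V} where

  ⊠-walk-gap≤length : ∀ {x y k} → Walk (PathGraph t ⊠ G) x y k → ∣ toℕ (proj₁ y) - toℕ (proj₁ x) ∣ ≤ k
  ⊠-walk-gap≤length {x} here = ≤-reflexive (∣n-n∣≡0 (toℕ (proj₁ x)))
  ⊠-walk-gap≤length {x} {y} (step {y = z} {k = k} e p) = begin
    ∣ toℕ (proj₁ y) - toℕ (proj₁ x) ∣                                 ≤⟨ ∣-∣-triangle (toℕ (proj₁ y)) (toℕ (proj₁ z)) (toℕ (proj₁ x)) ⟩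
    ∣ toℕ (proj₁ y) - toℕ (proj₁ z) ∣ + ∣ toℕ (proj₁ z) - toℕ (proj₁ x) ∣ ≤⟨ +-mono-≤ (⊠-walk-gap≤length p) (edge-gap≤1 e) ⟩
    k + 1                                                             ≡⟨ +-comm k 1 ⟩
    suc k                                                             ∎
    where
    open ≤-Reasoning
    edge-gap≤1 : ∀ {x y} → Adj (PathGraph t ⊠ G) x y → ∣ toℕ (proj₁ y) - toℕ (proj₁ x) ∣ ≤ 1
    edge-gap≤1 {x} (inj₁ (refl , _)) = ≤-trans (≤-reflexive (∣n-n∣≡0 (toℕ (proj₁ x)))) z≤n
    edge-gap≤1 (inj₂ (inj₁ (_ , e))) = PathAdj⇒gap≤1 e
    edge-gap≤1 (inj₂ (inj₂ (e , _))) = PathAdj⇒gap≤1 e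

  -- Distances in P_t ⊠ G are maxima of coordinate distances; here the path coordinate dominates.
  ⊠-dist-column : ∀ {a w b u d} → Dist (PathGraph t ⊠ G) (a , w) (b , u) d →
                  WalkWithin G ∣ toℕ b - toℕ a ∣ w u → d ≡ ∣ toℕ b - toℕ a ∣
  ⊠-dist-column {a} {b = b} (p , least) (l , l≤gap , q) =
    ≤-antisym (least _ (⊠-walk (pathWalk a b) q l≤gap)) (⊠-walk-gap≤length p)

module _ {t : ℕ} {V : Set} {G : Graph V} where

  open Landmarks G {Fin t × V} (toℕ ∘ proj₁) proj₂

  blindColumn⇒¬generator : ∀ {S} → BlindColumn 0 t S → ¬ IsLocalMetricGenerator (PathGraph t ⊠ G) S
  blindColumn⇒¬generator (i , _ , i<t , u , v , e , blinds) generator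
    with generator (fromℕ< i<t , u) (fromℕ< i<t , v) (inj₁ (refl , e))
  ... | s , s∈S , a , b , dist-a , dist-b , a≢b with All.lookup blinds s∈S
  ...   | blind (near-u , near-v) =
    a≢b (≡.trans (⊠-dist-column dist-a (at-column near-u)) (≡.sym (⊠-dist-column dist-b (at-column near-v))))
    where
    at-column : ∀ {x} → WalkWithin G (gap i s) (proj₂ s) x →
                WalkWithin G ∣ toℕ (fromℕ< i<t) - toℕ (proj₁ s) ∣ (proj₂ s) x
    at-column = subst (λ j → WalkWithin G ∣ j - toℕ (proj₁ s) ∣ (proj₂ s) _) (≡.sym (toℕ-fromℕ< i<t))

≤⌈/⌉⇒*≤ : ∀ {k a d} → k ≤ ⌈ a / suc d ⌉ → k * suc d ≤ a + d
≤⌈/⌉⇒*≤ {k} {a} {d} k≤ = ≤-trans (*-monoˡ-≤ (suc d) k≤) (m/n*n≤m (a + d) (suc d))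

≤⌈/⌉⇒span≤ : ∀ {D t k} → 1 ≤ D → 2 ≤ t → k ≤ ⌈ t ∸ 1 / D ⌉ → span D k ≤ t
≤⌈/⌉⇒span≤ {k = zero} _ 2≤t _ = 2≤t
≤⌈/⌉⇒span≤ {suc d} {t} {suc k} _ 2≤t k≤ =
  subst (_≤ t) (+-comm (suc (k * suc d)) 1)
    (m≤o∸n⇒m+n≤o (suc (k * suc d)) (≤-trans (s≤s z≤n) 2≤t)
      (+-cancelʳ-≤ d _ _ (≤-trans (≤-reflexive (cong suc (+-comm (k * suc d) d))) (≤⌈/⌉⇒*≤ k≤))))

theorem16 : ∀ (n : ℕ) (G : Graph (Fin n)) → 2 ≤ n → Connected G →
    ∀ (D : ℕ) → IsDiameter G D →
    ∀ (t : ℕ) → 2 * D + 1 ≤ t →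
    LocalDimAtLeast (PathGraph t ⊠ G) (⌈ t ∸ 1 / D ⌉ + 1)
theorem16 n G 2≤n conn D diam t 2D+1≤t S generator =
  decidable-stable (_ ≤? length S) λ few →
  ¬¬-allWithinDiameter conn diam λ within →
  let v₀ = fromℕ< 2≤n
      nb = neighbour conn 2≤n
      1≤D = 1≤diameter within (proj₂ (nb v₀))
      -- t ≥ 2D + 1 is used only through t ≥ 2.
      2≤t = ≤-trans (n≤1+n 2) (≤-trans (+-monoˡ-≤ 1 (*-monoʳ-≤ 2 1≤D)) 2D+1≤t)
      S≤⌈/⌉ = m<1+n⇒m≤n (subst (length S <_) (+-comm _ 1) (≰⇒> few))
      open Blindness G D v₀ nb within (toℕ ∘ proj₁) proj₂
  in blindColumn⇒¬generator (blindColumn (length S) S refl (≤⌈/⌉⇒span≤ 1≤D 2≤t S≤⌈/⌉)) generator
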